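{- Let $G$ be a finite simple undirected graph. For $S \subseteq V(G)$ let $\operatorname{mm}(S)$ denote the maximum cardinality of a matching in the bipartite graph $G[S, V(G)\setminus S]$. Then $\operatorname{mm}$ is submodular: for all $A, B \subseteq V(G)$, \[ \operatorname{mm}(A) + \operatorname{mm}(B) \geq \operatorname{mm}(A \cup B) + \operatorname{mm}(A \cap B). \]
   Context: For disjoint $X, Y \subseteq V(G)$, $G[X,Y]$ denotes the bipartite graph with vertex set $X \cup Y$ whose edges are the edges of $G$ with one endpoint in $X$ and the other in $Y$. -}

module Defs where

open import Data.Nat using (ℕ; _≤_)
open import Data.Bool using (Bool; true; false)
open import Data.Fin using (Fin)
open import Data.Fin.Subset using (Subset; _∈_; _∉_)
open import Data.Product using (_×_; _,_; Σ; proj₁; proj₂)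
open import Data.List using (List; []; _∷_; length; concatMap)
open import Data.List.Relation.Unary.All using (All)
open import Data.List.Relation.Unary.Unique.Propositional using (Unique)
open import Relation.Binary.PropositionalEquality using (_≡_)
open import Relation.Nullary using (¬_)

record Graph (n : ℕ) : Set where
  field
    adj   : Fin n → Fin n → Bool
    sym   : ∀ u v → adj u v ≡ adj v u
    irrefl : ∀ u → adj u u ≡ false

open Graph public

CrossEdge : ∀ {n} → Graph n → Subset n → Fin n × Fin n → Set
CrossEdge G S (u , v) = (u ∈ S) × (v ∉ S) × (adj G u v ≡ true)

endpoints : ∀ {n} → List (Fin n × Fin n) → List (Fin n)
endpoints = concatMap (λ e → proj₁ e ∷ proj₂ e ∷ [])

-- A matching in G[S, V(G) ∖ S]: a list of edges of that bipartite graph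
-- whose endpoints are pairwise distinct (so the edges are distinct and
-- pairwise disjoint); its cardinality is the length of the list.
IsCrossMatching : ∀ {n} → Graph n → Subset n → List (Fin n × Fin n) → Set
IsCrossMatching G S M = All (CrossEdge G S) M × Unique (endpoints M)

IsMM : ∀ {n} → Graph n → Subset n → ℕ → Set
IsMM G S k =
  Σ (List _) (λ M → IsCrossMatching G S M × length M ≡ k)
  × (∀ M → IsCrossMatching G S M → length M ≤ k)

module Submission where

-- Let P be a maximum matching of G[A ∪ B, V ∖ (A ∪ B)] and Q one of
-- G[A ∩ B, V ∖ (A ∩ B)].  We redistribute the edges of P and Q into a
-- matching N₁ of G[A, V ∖ A] and a matching N₂ of G[B, V ∖ B] with
-- |N₁| + |N₂| = |P| + |Q|; hence mm(A ∪ B) + mm(A ∩ B) ≤ mm(A) + mm(B).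
--
-- The redistribution is governed by a vertex set H which is a union of
-- components of P ∪ Q, contains B ∖ A and avoids A ∖ B: N₁ takes the edges of
-- P outside H and the edges of Q inside H, N₂ the remaining ones (module
-- Exchange).  As H we take the vertices reachable from B ∖ A by walks that
-- alternately follow P forwards and Q backwards; since P and Q are matchings
-- such a walk stays inside A ∩ B ∪ V ∖ (A ∪ B), and the set it sweeps out is
-- closed under both matchings (module AlternatingWalks).
--
-- Reachability is not constructively
-- decidable, but every predicate on Fin n is decidable up to double negation,
-- which suffices because the goal, an inequality of naturals, is decidable.

open import Defs
open import Data.Nat using (ℕ; _+_; _≤_)
open import Data.Fin.Subset using (Subset; _∪_; _∩_)

open import Level using (0ℓ)
open import Function using (_∘_)
open import Data.Nat using (zero; suc; _≤?_)
open import Data.Nat.Properties using (+-suc; +-comm; +-mono-≤; +-commutativeSemigroup; module ≤-Reasoning)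
open import Algebra.Properties.CommutativeSemigroup +-commutativeSemigroup using (interchange)
open import Data.Fin using (Fin; zero; suc)
open import Data.Fin.Subset using (_∈_; _∉_)
open import Data.Fin.Subset.Properties using (x∈p∪q⁻; x∈p∪q⁺; x∈p∩q⁻; x∈p∩q⁺; _∈?_)
open import Data.Product using (_×_; _,_; Σ; ∃; proj₁; proj₂)
open import Data.Sum using (_⊎_; inj₁; inj₂)
open import Data.Empty using (⊥; ⊥-elim)
open import Data.List using (List; []; _∷_; length; _++_; filter)
open import Data.List.Properties using (length-++; concatMap-++)
open import Data.List.Membership.Propositional using (find) renaming (_∈_ to _∈ₗ_; _∉_ to _∉ₗ_)
open import Data.List.Membership.Propositional.Properties using (∈-concatMap⁺; ∈-concatMap⁻; ∈-filter⁻)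
open import Data.List.Relation.Unary.Any as Any using (here; there)
open import Data.List.Relation.Unary.All as All using (All; []; _∷_)
import Data.List.Relation.Unary.All.Properties as All
open import Data.List.Relation.Unary.AllPairs using ([]; _∷_)
open import Data.List.Relation.Unary.Unique.Propositional using (Unique)
import Data.List.Relation.Unary.Unique.Propositional.Properties as Unique
open import Relation.Binary.PropositionalEquality using (_≡_; _≢_; refl; trans; cong; cong₂; subst; module ≡-Reasoning) renaming (sym to ≡-sym)
open import Relation.Nullary using (¬_; yes; no)
open import Relation.Nullary.Decidable.Core using (decidable-stable; ¬¬-excluded-middle)
open import Relation.Unary using (Pred; Decidable; ∁)
open import Relation.Unary.Properties using (∁?)

¬¬-decidable : ∀ {ℓ} {m} (R : Pred (Fin m) ℓ) → ¬ ¬ Decidable R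
¬¬-decidable {m = zero}  R k = k (λ ())
¬¬-decidable {m = suc m} R k =
  ¬¬-decidable (R ∘ suc) λ R∘suc? →
  ¬¬-excluded-middle λ R0? →
  k λ { zero → R0? ; (suc i) → R∘suc? i }

length-filter-∁ : ∀ {a ℓ} {X : Set a} {R : Pred X ℓ} (R? : Decidable R) (xs : List X)
  → length (filter R? xs) + length (filter (∁? R?) xs) ≡ length xs
length-filter-∁ R? [] = refl
length-filter-∁ R? (x ∷ xs) with R? x
... | yes _ = cong suc (length-filter-∁ R? xs)
... | no _  = trans (+-suc _ _) (cong suc (length-filter-∁ R? xs))

module _ {n : ℕ} where

  Edge : Set
  Edge = Fin n × Fin n

  ends : Edge → List (Fin n)
  ends (x , y) = x ∷ y ∷ []

  ends⊆endpoints : ∀ {M : List Edge} {e v} → e ∈ₗ M → v ∈ₗ ends e → v ∈ₗ endpoints M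
  ends⊆endpoints e∈M v∈e = ∈-concatMap⁺ ends (Any.map (λ { refl → v∈e }) e∈M)

  head-fresh : ∀ {e} {M : List Edge} {v} → Unique (endpoints (e ∷ M))
    → v ∈ₗ ends e → v ∉ₗ endpoints M
  head-fresh ((_ ∷ x∉M) ∷ _) (here refl)         v∈M = All.lookup x∉M v∈M refl
  head-fresh (_ ∷ y∉M ∷ _)   (there (here refl)) v∈M = All.lookup y∉M v∈M refl

  shared-endpoint : ∀ {M : List Edge} {e f v} → Unique (endpoints M)
    → e ∈ₗ M → f ∈ₗ M → v ∈ₗ ends e → v ∈ₗ ends f → e ≡ f
  shared-endpoint u           (here refl)  (here refl)  v∈e v∈f = refl
  shared-endpoint {_ ∷ M} u   (here refl)  (there f∈M)  v∈e v∈f =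
    ⊥-elim (head-fresh {M = M} u v∈e (ends⊆endpoints f∈M v∈f))
  shared-endpoint {_ ∷ M} u   (there e∈M)  (here refl)  v∈e v∈f =
    ⊥-elim (head-fresh {M = M} u v∈f (ends⊆endpoints e∈M v∈e))
  shared-endpoint (_ ∷ _ ∷ u) (there e∈M)  (there f∈M) v∈e v∈f =
    shared-endpoint u e∈M f∈M v∈e v∈f

  same-source : ∀ {M : List Edge} {x x' y} → Unique (endpoints M)
    → (x , y) ∈ₗ M → (x' , y) ∈ₗ M → x ≡ x'
  same-source u m m' = cong proj₁ (shared-endpoint u m m' (there (here refl)) (there (here refl)))

  same-target : ∀ {M : List Edge} {x y y'} → Unique (endpoints M)
    → (x , y) ∈ₗ M → (x , y') ∈ₗ M → y ≡ y'
  same-target u m m' = cong proj₂ (shared-endpoint u m m' (here refl) (here refl))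

  -- R is constant along the edges of M, i.e. R is a union of components of M.
  Respects : ∀ {ℓ} → Pred (Fin n) ℓ → List Edge → Set ℓ
  Respects R M = ∀ {x y} → (x , y) ∈ₗ M → (R x → R y) × (R y → R x)

  respects-∁ : ∀ {ℓ} {R : Pred (Fin n) ℓ} {M} → Respects R M → Respects (∁ R) M
  respects-∁ resp m = (λ ¬Rx Ry → ¬Rx (proj₂ (resp m) Ry)) , (λ ¬Ry Rx → ¬Ry (proj₁ (resp m) Rx))

  module _ {ℓ} {R : Pred (Fin n) ℓ} (R? : Decidable R) where

    select : List Edge → List Edge
    select = filter (R? ∘ proj₁)

    select-all : ∀ {c} {C : Pred Edge c} {M}
      → (∀ {e} → e ∈ₗ M → R (proj₁ e) → C e) → All C (select M)
    select-all f = All.tabulate λ e∈ → let e∈M , r = ∈-filter⁻ (R? ∘ proj₁) e∈ in f e∈M r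

    select-endpoint : ∀ {M v} → v ∈ₗ endpoints (select M)
      → ∃ λ e → e ∈ₗ M × R (proj₁ e) × v ∈ₗ ends e
    select-endpoint {M} v∈ =
      let e , e∈ , v∈e = find (∈-concatMap⁻ ends {xs = select M} v∈)
          e∈M , r = ∈-filter⁻ (R? ∘ proj₁) e∈
      in e , e∈M , r , v∈e

    select-endpoint-R : ∀ {M v} → Respects R M → v ∈ₗ endpoints (select M) → R v
    select-endpoint-R {M} resp v∈ with select-endpoint {M} v∈
    ... | _ , _   , Rx , here refl         = Rx
    ... | _ , e∈M , Rx , there (here refl) = proj₁ (resp e∈M) Rx

    select-unique : ∀ {M} → Unique (endpoints M) → Unique (endpoints (select M))
    select-unique {[]} u = []
    select-unique {(x , y) ∷ M} ((x≢y ∷ x∉M) ∷ y∉M ∷ u) with R? x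
    ... | yes _ = (x≢y ∷ restrict x∉M) ∷ restrict y∉M ∷ select-unique {M} u
      where
      restrict : ∀ {z} → All (z ≢_) (endpoints M) → All (z ≢_) (endpoints (select M))
      restrict = All.anti-mono λ v∈ →
        let _ , e∈M , _ , v∈e = select-endpoint {M} v∈ in ends⊆endpoints e∈M v∈e
    ... | no _  = select-unique {M} u

  separated-union : ∀ {ℓ ℓ'} {R : Pred (Fin n) ℓ} {S : Pred (Fin n) ℓ'}
    (R? : Decidable R) (S? : Decidable S) {M N : List Edge}
    → Respects R M → Respects S N → (∀ {v} → R v → S v → ⊥)
    → Unique (endpoints M) → Unique (endpoints N)
    → Unique (endpoints (select R? M ++ select S? N))
  separated-union R? S? {M} {N} R-M S-N disjoint uM uN =
    subst Unique (≡-sym (concatMap-++ ends (select R? M) (select S? N)))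
      (Unique.++⁺ (select-unique R? {M} uM) (select-unique S? {N} uN)
        λ (v∈₁ , v∈₂) → disjoint (select-endpoint-R R? {M} R-M v∈₁) (select-endpoint-R S? {N} S-N v∈₂))

module Exchange {n} (G : Graph n) (A B : Subset n) (P Q : List (Edge {n}))
  (P-match : IsCrossMatching G (A ∪ B) P) (Q-match : IsCrossMatching G (A ∩ B) Q)
  {ℓ} {H : Pred (Fin n) ℓ} (H? : Decidable H) (H-P : Respects H P) (H-Q : Respects H Q)
  (B∖A⊆H : ∀ {v} → v ∈ B → v ∉ A → H v) (H∩A⊆B : ∀ {v} → H v → v ∈ A → v ∈ B)
  where

  N₁ N₂ : List Edge
  N₁ = select (∁? H?) P ++ select H? Q
  N₂ = select H? P ++ select (∁? H?) Q

  -- A P-edge starting outside H crosses from A: its source is not in B ∖ A.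
  P-outside : ∀ {e} → e ∈ₗ P → ¬ H (proj₁ e) → CrossEdge G A e
  P-outside {x , y} m ¬Hx with All.lookup (proj₁ P-match) m
  ... | x∈A∪B , y∉A∪B , xy = x∈A , (λ y∈A → y∉A∪B (x∈p∪q⁺ (inj₁ y∈A))) , xy
    where
    x∈A : x ∈ A
    x∈A with x∈p∪q⁻ A B x∈A∪B
    ... | inj₁ x∈A = x∈A
    ... | inj₂ x∈B = decidable-stable (x ∈? A) (λ x∉A → ¬Hx (B∖A⊆H x∈B x∉A))

  -- A Q-edge inside H crosses from A: its target is in H, hence not in A ∖ B.
  Q-inside : ∀ {e} → e ∈ₗ Q → H (proj₁ e) → CrossEdge G A e
  Q-inside {x , y} m Hx with All.lookup (proj₁ Q-match) m
  ... | x∈A∩B , y∉A∩B , xy =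
    proj₁ (x∈p∩q⁻ A B x∈A∩B) ,
    (λ y∈A → y∉A∩B (x∈p∩q⁺ (y∈A , H∩A⊆B (proj₁ (H-Q m) Hx) y∈A))) ,
    xy

  -- A P-edge inside H crosses from B: its source is not in A ∖ B.
  P-inside : ∀ {e} → e ∈ₗ P → H (proj₁ e) → CrossEdge G B e
  P-inside {x , y} m Hx with All.lookup (proj₁ P-match) m
  ... | x∈A∪B , y∉A∪B , xy = x∈B , (λ y∈B → y∉A∪B (x∈p∪q⁺ (inj₂ y∈B))) , xy
    where
    x∈B : x ∈ B
    x∈B with x∈p∪q⁻ A B x∈A∪B
    ... | inj₁ x∈A = H∩A⊆B Hx x∈A
    ... | inj₂ x∈B = x∈B

  -- A Q-edge outside H crosses from B: its target is not in B ∖ A.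
  Q-outside : ∀ {e} → e ∈ₗ Q → ¬ H (proj₁ e) → CrossEdge G B e
  Q-outside {x , y} m ¬Hx with All.lookup (proj₁ Q-match) m
  ... | x∈A∩B , y∉A∩B , xy = proj₂ (x∈p∩q⁻ A B x∈A∩B) , y∉B , xy
    where
    y∉B : y ∉ B
    y∉B y∈B with y ∈? A
    ... | yes y∈A = y∉A∩B (x∈p∩q⁺ (y∈A , y∈B))
    ... | no y∉A  = ¬Hx (proj₂ (H-Q m) (B∖A⊆H y∈B y∉A))

  -- The two parts of N₁ (and of N₂) lie on opposite sides of H, so their
  -- endpoints are disjoint.
  N₁-matching : IsCrossMatching G A N₁
  N₁-matching =
    All.++⁺ (select-all (∁? H?) P-outside) (select-all H? Q-inside) ,
    separated-union (∁? H?) H? (respects-∁ H-P) H-Q (λ ¬Hv Hv → ¬Hv Hv)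
      (proj₂ P-match) (proj₂ Q-match)

  N₂-matching : IsCrossMatching G B N₂
  N₂-matching =
    All.++⁺ (select-all H? P-inside) (select-all (∁? H?) Q-outside) ,
    separated-union H? (∁? H?) H-P (respects-∁ H-Q) (λ Hv ¬Hv → ¬Hv Hv)
      (proj₂ P-match) (proj₂ Q-match)

  size : length N₁ + length N₂ ≡ length P + length Q
  size = begin
    length N₁ + length N₂
      ≡⟨ cong₂ _+_ (length-++ (select (∁? H?) P)) (length-++ (select H? P)) ⟩
    (p̄ + q) + (p + q̄)
      ≡⟨ interchange p̄ q p q̄ ⟩
    (p̄ + p) + (q + q̄)
      ≡⟨ cong₂ _+_ (trans (+-comm p̄ p) (length-filter-∁ (H? ∘ proj₁) P))
                   (length-filter-∁ (H? ∘ proj₁) Q) ⟩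
    length P + length Q ∎
    where
    open ≡-Reasoning
    p p̄ q q̄ : ℕ
    p = length (select H? P)
    p̄ = length (select (∁? H?) P)
    q = length (select H? Q)
    q̄ = length (select (∁? H?) Q)

module AlternatingWalks {n} (G : Graph n) (A B : Subset n) (P Q : List (Edge {n}))
  (P-match : IsCrossMatching G (A ∪ B) P) (Q-match : IsCrossMatching G (A ∩ B) Q)
  where

  P-source : ∀ {x y} → (x , y) ∈ₗ P → x ∈ A ∪ B
  P-source m = proj₁ (All.lookup (proj₁ P-match) m)

  P-target : ∀ {x y} → (x , y) ∈ₗ P → y ∉ A ∪ B
  P-target m = proj₁ (proj₂ (All.lookup (proj₁ P-match) m))

  Q-source : ∀ {x y} → (x , y) ∈ₗ Q → x ∈ A ∩ B
  Q-source m = proj₁ (All.lookup (proj₁ Q-match) m)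

  Q-target : ∀ {x y} → (x , y) ∈ₗ Q → y ∉ A ∩ B
  Q-target m = proj₁ (proj₂ (All.lookup (proj₁ Q-match) m))

  ∩⊆∪ : ∀ {v} → v ∈ A ∩ B → v ∈ A ∪ B
  ∩⊆∪ v∈A∩B = x∈p∪q⁺ (inj₁ (proj₁ (x∈p∩q⁻ A B v∈A∩B)))

  -- Vertices reached by a P-edge (outer) or by a Q-edge backwards (inner).
  data Side : Set where
    inner outer : Side

  data Walk (u : Fin n) : Fin n → Side → Set where
    P-first : ∀ {y}   → (u , y) ∈ₗ P → Walk u y outer
    Q-first : ∀ {x}   → (x , u) ∈ₗ Q → Walk u x inner
    P-step  : ∀ {x y} → Walk u x inner → (x , y) ∈ₗ P → Walk u y outer
    Q-step  : ∀ {x y} → Walk u y outer → (x , y) ∈ₗ Q → Walk u x inner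

  outer-∉ : ∀ {u v} → Walk u v outer → v ∉ A ∪ B
  outer-∉ (P-first m)  = P-target m
  outer-∉ (P-step _ m) = P-target m

  inner-∈ : ∀ {u v} → Walk u v inner → v ∈ A ∩ B
  inner-∈ (Q-first m)  = Q-source m
  inner-∈ (Q-step _ m) = Q-source m

  Reach : Fin n → Fin n → Set
  Reach u v = v ≡ u ⊎ Σ Side (Walk u v)

  -- From a vertex of B ∖ A, the reachable set is closed under both matchings
  -- in both directions: the only edge of P or Q at a walk's endpoint not
  -- continuing the walk is the one it arrived by.
  module Closure {u : Fin n} (u∈B : u ∈ B) (u∉A : u ∉ A) where

    along-P : ∀ {x y} → Reach u x → (x , y) ∈ₗ P → Reach u y
    along-P (inj₁ refl)          m = inj₂ (outer , P-first m)
    along-P (inj₂ (outer , w))   m = ⊥-elim (outer-∉ w (P-source m))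
    along-P (inj₂ (inner , w))   m = inj₂ (outer , P-step w m)

    back-P : ∀ {x y} → Reach u y → (x , y) ∈ₗ P → Reach u x
    back-P (inj₁ refl)                     m = ⊥-elim (P-target m (x∈p∪q⁺ (inj₂ u∈B)))
    back-P (inj₂ (outer , P-first m'))     m = inj₁ (same-source (proj₂ P-match) m m')
    back-P (inj₂ (outer , P-step w m'))    m
      with refl ← same-source (proj₂ P-match) m m' = inj₂ (inner , w)
    back-P (inj₂ (inner , w))              m = ⊥-elim (P-target m (∩⊆∪ (inner-∈ w)))

    along-Q : ∀ {x y} → Reach u x → (x , y) ∈ₗ Q → Reach u y
    along-Q (inj₁ refl)                    m = ⊥-elim (u∉A (proj₁ (x∈p∩q⁻ A B (Q-source m))))
    along-Q (inj₂ (outer , w))             m = ⊥-elim (outer-∉ w (∩⊆∪ (Q-source m)))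
    along-Q (inj₂ (inner , Q-first m'))    m = inj₁ (same-target (proj₂ Q-match) m m')
    along-Q (inj₂ (inner , Q-step w m'))   m
      with refl ← same-target (proj₂ Q-match) m m' = inj₂ (outer , w)

    back-Q : ∀ {x y} → Reach u y → (x , y) ∈ₗ Q → Reach u x
    back-Q (inj₁ refl)        m = inj₂ (inner , Q-first m)
    back-Q (inj₂ (outer , w)) m = inj₂ (inner , Q-step w m)
    back-Q (inj₂ (inner , w)) m = ⊥-elim (Q-target m (inner-∈ w))

  H : Pred (Fin n) 0ℓ
  H v = Σ (Fin n) λ u → u ∈ B × u ∉ A × Reach u v

  H-P : Respects H P
  H-P m = (λ (u , u∈B , u∉A , r) → u , u∈B , u∉A , Closure.along-P u∈B u∉A r m)
        , (λ (u , u∈B , u∉A , r) → u , u∈B , u∉A , Closure.back-P u∈B u∉A r m)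

  H-Q : Respects H Q
  H-Q m = (λ (u , u∈B , u∉A , r) → u , u∈B , u∉A , Closure.along-Q u∈B u∉A r m)
        , (λ (u , u∈B , u∉A , r) → u , u∈B , u∉A , Closure.back-Q u∈B u∉A r m)

  B∖A⊆H : ∀ {v} → v ∈ B → v ∉ A → H v
  B∖A⊆H {v} v∈B v∉A = v , v∈B , v∉A , inj₁ refl

  -- H avoids A ∖ B: walks only visit A ∩ B and the complement of A ∪ B.
  H∩A⊆B : ∀ {v} → H v → v ∈ A → v ∈ B
  H∩A⊆B (u , _ , u∉A , inj₁ refl)        v∈A = ⊥-elim (u∉A v∈A)
  H∩A⊆B (_ , _ , _   , inj₂ (outer , w)) v∈A = ⊥-elim (outer-∉ w (x∈p∪q⁺ (inj₁ v∈A)))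
  H∩A⊆B (_ , _ , _   , inj₂ (inner , w)) v∈A = proj₂ (x∈p∩q⁻ A B (inner-∈ w))

theorem3 : ∀ {n} (G : Graph n) (A B : Subset n) (a b c d : ℕ)
    → IsMM G A a → IsMM G B b → IsMM G (A ∪ B) c → IsMM G (A ∩ B) d
    → c + d ≤ a + b
theorem3 G A B a b c d (_ , max-A) (_ , max-B) ((P , P-match , |P|≡c) , _) ((Q , Q-match , |Q|≡d) , _) =
  decidable-stable (c + d ≤? a + b) λ c+d≰a+b →
    ¬¬-decidable W.H λ H? → c+d≰a+b (bound H?)
  where
  module W = AlternatingWalks G A B P Q P-match Q-match

  bound : Decidable W.H → c + d ≤ a + b
  bound H? = begin
    c + d                 ≡⟨ cong₂ _+_ (≡-sym |P|≡c) (≡-sym |Q|≡d) ⟩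
    length P + length Q   ≡⟨ ≡-sym X.size ⟩
    length X.N₁ + length X.N₂ ≤⟨ +-mono-≤ (max-A X.N₁ X.N₁-matching) (max-B X.N₂ X.N₂-matching) ⟩
    a + b                 ∎
    where
    open ≤-Reasoning
    module X = Exchange G A B P Q P-match Q-match H? W.H-P W.H-Q W.B∖A⊆H W.H∩A⊆B
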